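{- Let $G=(I\uplus S\uplus O,E)$ be a splitter network with capacities $c$. If $(t,F)$ is a steady-state for $(G,c)$, then there is a steady-state $(t,F')$ for $(G,c)$ with $F\subseteq F'$ that satisfies the strong maximization rule: for any arcs $uv\in E\setminus F'$ and $vw\in F'$, $t(vw)=1$.
   Context: A splitter network is a finite directed graph $G$ (loops and parallel arcs allowed) with arc set $E$ whose vertex set is partitioned as $I\uplus S\uplus O$, where each input $i\in I$ has out-degree $1$ and in-degree $0$, each output $o\in O$ has in-degree $1$ and out-degree $0$, and each splitter $s\in S$ has in-degree $2$ and out-degree $2$. $\delta^+(v),\delta^-(v)$ denote outgoing/incoming arcs of $v$. A capacity function is a map $c:I\cup O\to[0,1]$. A steady-state for $(G,c)$ is a pair $(t,F)$ with $t:E\to[0,1]$ and $F\subseteq E$ (fluid arcs; arcs of $E\setminus F$ are saturated) such that: (R3) for each input $i$ with $\delta^+(i)=\{e\}$, $t(e)\le c(i)$, and if $e\in F$ then $t(e)=c(i)$; (R4) for each output $o$ with $\delta^-(o)=\{e\}$, $t(e)\le c(o)$, and if $e\notin F$ then $t(e)=c(o)$; (R5) for each splitter $s$, $t(\delta^-(s))=t(\delta^+(s))$; (R6) for each splitter $s$ with $\delta^-(s)=\{e_1,e_2\}$ and $e_1\notin F$, $t(e_1)\ge t(e_2)$; (R7) for each splitter $s$ with $\delta^+(s)=\{e_1,e_2\}$ and $e_1\in F$, $t(e_1)\ge t(e_2)$; (R8) for any arcs $uv\in E\setminus F$ and $vw\in F$, $t(uv)=1$ or $t(vw)=1$.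
   Formalization: The capacities c and the throughputs t take rational values in [0,1] rather than real ones. -}

module Defs where

open import Data.Nat using (ℕ)
open import Data.Fin using (Fin; _≟_)
open import Data.Fin.Subset using (Subset; _∈_; _∉_; _⊆_)
open import Data.List using (List; length; filter; map; foldr)
open import Data.List.Base using () renaming (allFin to allFinL)
open import Data.Rational using (ℚ; 0ℚ; 1ℚ; _+_; _≤_)
open import Data.Product using (_×_)
open import Data.Sum using (_⊎_)
open import Relation.Binary.PropositionalEquality using (_≡_; _≢_)

data Kind : Set where
  input splitter output : Kind

-- A finite directed multigraph (loops and parallel arcs allowed) with
-- vertices Fin n and arcs Fin m; arc e goes from tl e to hd e.
record Network : Set where
  field
    n m  : ℕ
    kind : Fin n → Kind
    tl   : Fin m → Fin n
    hd   : Fin m → Fin n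

  δ⁺ : Fin n → List (Fin m)
  δ⁺ v = filter (λ e → tl e ≟ v) (allFinL m)

  δ⁻ : Fin n → List (Fin m)
  δ⁻ v = filter (λ e → hd e ≟ v) (allFinL m)

open Network public

record IsSplitterNetwork (G : Network) : Set where
  field
    input-deg    : ∀ v → kind G v ≡ input    → length (δ⁺ G v) ≡ 1 × length (δ⁻ G v) ≡ 0
    output-deg   : ∀ v → kind G v ≡ output   → length (δ⁻ G v) ≡ 1 × length (δ⁺ G v) ≡ 0
    splitter-deg : ∀ v → kind G v ≡ splitter → length (δ⁻ G v) ≡ 2 × length (δ⁺ G v) ≡ 2

InUnit : ℚ → Set
InUnit x = 0ℚ ≤ x × x ≤ 1ℚ

-- A capacity function c : I ∪ O → [0,1]; represented as a function on all
-- vertices whose values on splitters are irrelevant.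
IsCapacity : (G : Network) → (Fin (n G) → ℚ) → Set
IsCapacity G c = ∀ v → kind G v ≢ splitter → InUnit (c v)

sumℚ : List ℚ → ℚ
sumℚ = foldr _+_ 0ℚ

-- Steady-state (t , F) for (G , c); F is the set of fluid arcs.
record SteadyState (G : Network) (c : Fin (n G) → ℚ)
                   (t : Fin (m G) → ℚ) (F : Subset (m G)) : Set where
  field
    t-range : ∀ e → InUnit (t e)
    R3 : ∀ i e → kind G i ≡ input → tl G e ≡ i →
           t e ≤ c i × (e ∈ F → t e ≡ c i)
    R4 : ∀ o e → kind G o ≡ output → hd G e ≡ o →
           t e ≤ c o × (e ∉ F → t e ≡ c o)
    R5 : ∀ s → kind G s ≡ splitter →
           sumℚ (map t (δ⁻ G s)) ≡ sumℚ (map t (δ⁺ G s))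
    R6 : ∀ s e₁ e₂ → kind G s ≡ splitter → e₁ ≢ e₂ →
           hd G e₁ ≡ s → hd G e₂ ≡ s → e₁ ∉ F → t e₂ ≤ t e₁
    R7 : ∀ s e₁ e₂ → kind G s ≡ splitter → e₁ ≢ e₂ →
           tl G e₁ ≡ s → tl G e₂ ≡ s → e₁ ∈ F → t e₂ ≤ t e₁
    R8 : ∀ e₁ e₂ → hd G e₁ ≡ tl G e₂ → e₁ ∉ F → e₂ ∈ F →
           t e₁ ≡ 1ℚ ⊎ t e₂ ≡ 1ℚ

StrongMax : (G : Network) (t : Fin (m G) → ℚ) (F : Subset (m G)) → Set
StrongMax G t F = ∀ e₁ e₂ → hd G e₁ ≡ tl G e₂ → e₁ ∉ F → e₂ ∈ F → t e₂ ≡ 1ℚ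

{-# OPTIONS --safe #-}
-- Add to F every arc carrying throughput 1.  Rules R4 and R6 only constrain
-- saturated arcs, which become fewer; R3 and R7 gain new fluid arcs e, but
-- t e = 1 forces t e = c i (capacities are at most 1) and t e ≥ t e₂.
-- R8 survives because any new fluid arc has throughput 1, and with every
-- throughput-1 arc fluid, R8 can only hold through its second disjunct.
module Submission where

open import Level using (Level)
open import Defs
open import Data.Nat using (ℕ)
open import Data.Fin using (Fin)
open import Data.Fin.Subset using (Subset; _⊆_; _∈_; _∪_)
open import Data.Fin.Subset.Properties using (p⊆p∪q; x∈p∪q⁺; x∈p∪q⁻)
open import Data.Rational using (ℚ; 1ℚ; _≤_)
open import Data.Rational.Properties using (≤-antisym) renaming (_≟_ to _≟ℚ_)
open import Data.Product using (Σ; _×_; _,_; proj₁; proj₂)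
open import Data.Sum using (_⊎_; inj₁; inj₂; [_,_])
open import Data.Vec using (tabulate)
open import Data.Vec.Properties using (lookup∘tabulate; []=⇒lookup; lookup⇒[]=)
open import Function using (_∘_; id)
open import Relation.Nullary using (yes; no; does; contradiction)
open import Relation.Nullary.Decidable using (dec-true)
open import Relation.Unary using (Pred; Decidable)
open import Relation.Binary.PropositionalEquality using (_≡_; _≢_; sym; trans; subst)

module _ {ℓ : Level} {k : ℕ} {P : Pred (Fin k) ℓ} (P? : Decidable P) where

  toSubset : Subset k
  toSubset = tabulate (does ∘ P?)

  ∈-toSubset⁺ : ∀ {x} → P x → x ∈ toSubset
  ∈-toSubset⁺ {x} px = lookup⇒[]= x _ (trans (lookup∘tabulate _ x) (dec-true (P? x) px))

  ∈-toSubset⁻ : ∀ {x} → x ∈ toSubset → P x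
  ∈-toSubset⁻ {x} x∈ with P? x | trans (sym (lookup∘tabulate (does ∘ P?) x)) ([]=⇒lookup x∈)
  ... | yes px | _  = px
  ... | no _   | ()

input≢splitter : ∀ (G : Network) {v} → kind G v ≡ input → kind G v ≢ splitter
input≢splitter _ ki ks with trans (sym ki) ks
... | ()

module _ {G : Network} {c : Fin (n G) → ℚ} {t : Fin (m G) → ℚ} where

  steadyState-extendFluid : IsCapacity G c → ∀ {F F′} → SteadyState G c t F →
                            F ⊆ F′ → (∀ {e} → e ∈ F′ → e ∈ F ⊎ t e ≡ 1ℚ) →
                            SteadyState G c t F′
  steadyState-extendFluid cap ss F⊆F′ F′⊆F∪≡1 = record
    { t-range = t-range
    ; R3 = λ i e ki te →
        let t≤c , t≡c = R3 i e ki te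
            c≤1 = proj₂ (cap i (input≢splitter G ki))
        in t≤c , [ t≡c , (λ t≡1 → ≤-antisym t≤c (subst (c i ≤_) (sym t≡1) c≤1)) ] ∘ F′⊆F∪≡1
    ; R4 = λ o e ko he → proj₁ (R4 o e ko he) , λ e∉F′ → proj₂ (R4 o e ko he) (e∉F′ ∘ F⊆F′)
    ; R5 = R5
    ; R6 = λ s e₁ e₂ ks e₁≢e₂ h₁ h₂ e₁∉F′ → R6 s e₁ e₂ ks e₁≢e₂ h₁ h₂ (e₁∉F′ ∘ F⊆F′)
    ; R7 = λ s e₁ e₂ ks e₁≢e₂ t₁ t₂ →
        [ R7 s e₁ e₂ ks e₁≢e₂ t₁ t₂ , (λ t≡1 → subst (t e₂ ≤_) (sym t≡1) (proj₂ (t-range e₂))) ]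
        ∘ F′⊆F∪≡1
    ; R8 = λ e₁ e₂ h e₁∉F′ → [ R8 e₁ e₂ h (e₁∉F′ ∘ F⊆F′) , inj₂ ] ∘ F′⊆F∪≡1
    }
    where open SteadyState ss

  ≡1⊆fluid⇒strongMax : ∀ {F} → SteadyState G c t F → (∀ {e} → t e ≡ 1ℚ → e ∈ F) →
                       StrongMax G t F
  ≡1⊆fluid⇒strongMax ss ≡1⊆F e₁ e₂ h e₁∉F e₂∈F =
    [ (λ t₁≡1 → contradiction (≡1⊆F t₁≡1) e₁∉F) , id ]
      (SteadyState.R8 ss e₁ e₂ h e₁∉F e₂∈F)

lemma4 : (G : Network) → IsSplitterNetwork G →
         (c : Fin (n G) → ℚ) → IsCapacity G c →
         (t : Fin (m G) → ℚ) (F : Subset (m G)) → SteadyState G c t F →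
         Σ (Subset (m G)) (λ F′ → F ⊆ F′ × SteadyState G c t F′ × StrongMax G t F′)
lemma4 G _ c cap t F ss =
  F ∪ T , F⊆F′ , ss′ , ≡1⊆fluid⇒strongMax ss′ (x∈p∪q⁺ ∘ inj₂ ∘ ∈-toSubset⁺ t≟1)
  where
  t≟1 : Decidable (λ e → t e ≡ 1ℚ)
  t≟1 e = t e ≟ℚ 1ℚ

  T : Subset (m G)
  T = toSubset t≟1

  F⊆F′ : F ⊆ F ∪ T
  F⊆F′ = p⊆p∪q T

  ss′ : SteadyState G c t (F ∪ T)
  ss′ = steadyState-extendFluid cap ss F⊆F′ ([ inj₁ , inj₂ ∘ ∈-toSubset⁻ t≟1 ] ∘ x∈p∪q⁻ F T)
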